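{- Let $\tilde{x}$ be a circular word and $x$ any linearisation of $\tilde{x}$. Then $\mathcal{M}_{\tilde{x}}=\mathcal{M}_{xx}^{|x|}$, i.e., the minimal absent words of $\tilde{x}$ are exactly the minimal absent words of the linear word $xx$ whose length is at most $|x|$.
   Context: For a word $x$ of length $m$ and $0\le i<m$, the $i$-th rotation is $x^{\langle i\rangle}=x[i..m-1]x[0..i-1]$. A circular word $\tilde x$ is an equivalence class of words under the relation "is a rotation of"; its members are its linearisations. For a factorial language $L$ (closed under taking factors) over $\Sigma$, $\mathcal{M}_L=\{aub : a,b\in\Sigma,\ u\in\Sigma^*,\ aub\notin L,\ au\in L,\ ub\in L\}$. $\mathcal{F}_{x^*}$ is the set of all factors of words in $\{x^k:k\ge 0\}$, and $\mathcal{M}_{\tilde{x}}:=\mathcal{M}_{\mathcal{F}_{x^*}}$ (independent of the linearisation). For a linear word $w$, $\mathcal{M}_w$ is the set of minimal absent words of $w$ (words not occurring in $w$ all of whose proper factors occur in $w$), and $\mathcal{M}_w^{\ell}$ is the subset of those of length at most $\ell$. -}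

module Defs where

open import Data.Nat using (ℕ; _<_; _≤_)
open import Data.List using (List; []; _∷_; _++_; length; concat; replicate)
open import Data.Product using (Σ; ∃; ∃-syntax; _×_; _,_)
open import Relation.Nullary using (¬_)
open import Relation.Binary.PropositionalEquality using (_≡_)

module _ {A : Set} where

  Factor : List A → List A → Set
  Factor u w = ∃[ p ] ∃[ s ] (p ++ u ++ s ≡ w)

  pow : List A → ℕ → List A
  pow x k = concat (replicate k x)

  FactPow : List A → List A → Set
  FactPow x u = ∃[ k ] Factor u (pow x k)

  MinForb : (List A → Set) → List A → Set
  MinForb L w = ∃[ a ] ∃[ u ] ∃[ b ]
    (w ≡ a ∷ u ++ b ∷ []) × ¬ L (a ∷ u ++ b ∷ []) × L (a ∷ u) × L (u ++ b ∷ [])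

  MinForbCirc : List A → List A → Set
  MinForbCirc x = MinForb (FactPow x)

  MAW : List A → List A → Set
  MAW w v = ¬ Factor v w × (∀ u → Factor u v → length u < length v → Factor u w)

  MAWUpTo : List A → ℕ → List A → Set
  MAWUpTo w ℓ v = MAW w v × length v ≤ ℓ

module Submission where

-- Write F for the factorial language of factors of the powers x^k.
--  * Alignment.  A word lies in F iff it is a prefix of r^m for some
--    rotation r of x (it "reads x cyclically, starting at phase r").
--  * Short factors.  A word of F of length ≤ |x| is a prefix of a single
--    rotation r, and every rotation is a factor of xx; conversely factors
--    of xx are in F.  So F and the factors of xx agree up to length |x|.
--  * Extension.  If au ∈ F and ub ∈ F with |ub| ≥ |x|, then aub ∈ F: the
--    phase of u read after a also fits ub (two rotations that are prefixes
--    of the same word coincide; if |ub| = |x| both u·b and u·d are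
--    rotations of x, so b = d by counting letters).  Hence every element
--    aub of M_F has length ≤ |x|.
-- Both inclusions of the theorem then follow by transporting "occurs"
-- and "is absent" between F and the factors of xx at lengths ≤ |x|;
-- the hypothesis that every letter occurs in x excludes one-letter
-- minimal absent words of xx, which have no decomposition a·u·b.

open import Defs
open import Data.List using (List; []; _∷_; _++_; length; initLast; _∷ʳ′_)
open import Data.List.Properties using (++-assoc; ++-identityʳ; length-++; length-++-comm; ∷-injective; ∷-injectiveˡ; ∷-injectiveʳ)
open import Data.List.Relation.Binary.Permutation.Propositional using (_↭_; ↭-sym; ↭-trans)
open import Data.List.Relation.Binary.Permutation.Propositional.Properties using (++-comm; drop-∷; ↭-singleton-inv)
open import Data.Nat using (ℕ; zero; suc; _≤_; _<_; s≤s; _≤?_)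
open import Data.Nat.Properties using (≰⇒>; <⇒≤; ≤-trans; ≤-reflexive; ≤-pred; ≤-antisym; ≤-refl; n≤1+n; +-comm; suc-injective)
open import Data.Product using (_×_; ∃-syntax; _,_; proj₁; proj₂)
open import Data.Sum using (_⊎_; inj₁; inj₂)
open import Data.Empty using (⊥-elim)
open import Function using (_∘_)
open import Relation.Nullary using (¬_; yes; no)
open import Relation.Binary.PropositionalEquality using (_≡_; refl; sym; trans; cong; subst; subst₂; module ≡-Reasoning)
open ≡-Reasoning

module _ {A : Set} where

  Prefix : List A → List A → Set
  Prefix u w = ∃[ t ] (u ++ t ≡ w)

  prefix⇒factor : {u w : List A} → Prefix u w → Factor u w
  prefix⇒factor (t , e) = [] , t , e

  factor-trans : {u v w : List A} → Factor u v → Factor v w → Factor u w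
  factor-trans {u} (p , s , refl) (p' , s' , refl) = p' ++ p , s ++ s' , (begin
    (p' ++ p) ++ u ++ s ++ s'    ≡⟨ ++-assoc p' p _ ⟩
    p' ++ p ++ u ++ s ++ s'      ≡⟨ cong (λ w → p' ++ p ++ w) (++-assoc u s s') ⟨
    p' ++ p ++ (u ++ s) ++ s'    ≡⟨ cong (p' ++_) (++-assoc p (u ++ s) s') ⟨
    p' ++ (p ++ u ++ s) ++ s'    ∎)

  levi : (p w x y : List A) → p ++ w ≡ x ++ y →
         (∃[ q ] (p ≡ x ++ q × q ++ w ≡ y)) ⊎ (∃[ q ] (x ≡ p ++ q × w ≡ q ++ y))
  levi []      w x       y e = inj₂ (x , refl , e)
  levi (c ∷ p) w []      y e = inj₁ (c ∷ p , refl , e)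
  levi (c ∷ p) w (d ∷ x) y e with ∷-injective e
  ... | refl , e' with levi p w x y e'
  ...   | inj₁ (q , p≡xq , qw≡y) = inj₁ (q , cong (c ∷_) p≡xq , qw≡y)
  ...   | inj₂ (q , x≡pq , w≡qy) = inj₂ (q , cong (c ∷_) x≡pq , w≡qy)

  prefix-trans : {u v w : List A} → Prefix u v → Prefix v w → Prefix u w
  prefix-trans {u} (t , refl) (t' , refl) = t ++ t' , sym (++-assoc u t t')

  prefix-compare : {u v w : List A} → Prefix u w → Prefix v w → length u ≤ length v → Prefix u v
  prefix-compare {[]}    {v}     _        _         _         = v , refl
  prefix-compare {c ∷ u} {[]}    _        _         ()
  prefix-compare {c ∷ u} {d ∷ v} (t , refl) (t' , e) (s≤s le) with ∷-injective e
  ... | refl , e' with prefix-compare {u} {v} (t , refl) (t' , e') le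
  ...   | r , ur≡v = r , cong (c ∷_) ur≡v

  prefix-full : {u w : List A} → Prefix u w → length w ≤ length u → u ≡ w
  prefix-full {[]}    ([] , refl)    _        = refl
  prefix-full {c ∷ u} (t , refl)     (s≤s le) = cong (c ∷_) (prefix-full {u} (t , refl) le)

  prefix-unique : {u v w : List A} → Prefix u w → Prefix v w → length u ≡ length v → u ≡ v
  prefix-unique pu pv e = prefix-full (prefix-compare pu pv (≤-reflexive e)) (≤-reflexive (sym e))

  prefix-last : {u w : List A} → Prefix u w → length w ≡ suc (length u) → ∃[ e ] (w ≡ u ++ e ∷ [])
  prefix-last {[]}    (e ∷ [] , refl) _  = e , refl
  prefix-last {c ∷ u} (t , refl)      eq with prefix-last {u} (t , refl) (suc-injective eq)
  ... | e , w≡ue = e , cong (c ∷_) w≡ue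

  length-snoc : (u : List A) (b : A) → length (u ++ b ∷ []) ≡ suc (length u)
  length-snoc u b = trans (length-++ u) (+-comm (length u) 1)

  pow-conj : (p z : List A) (k : ℕ) → pow (p ++ z) k ++ p ≡ p ++ pow (z ++ p) k
  pow-conj p z zero    = sym (++-identityʳ p)
  pow-conj p z (suc k) = begin
    ((p ++ z) ++ pow (p ++ z) k) ++ p  ≡⟨ ++-assoc (p ++ z) _ p ⟩
    (p ++ z) ++ pow (p ++ z) k ++ p    ≡⟨ cong ((p ++ z) ++_) (pow-conj p z k) ⟩
    (p ++ z) ++ p ++ pow (z ++ p) k    ≡⟨ ++-assoc p z _ ⟩
    p ++ z ++ p ++ pow (z ++ p) k      ≡⟨ cong (p ++_) (++-assoc z p _) ⟨
    p ++ (z ++ p) ++ pow (z ++ p) k    ∎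

  pow-snoc : (x : List A) (k : ℕ) → pow x k ++ x ≡ x ++ pow x k
  pow-snoc x k = subst (λ y → pow y k ++ x ≡ x ++ pow x k) (++-identityʳ x) (pow-conj x [] k)

  pow-[] : (k : ℕ) → pow {A} [] k ≡ []
  pow-[] zero    = refl
  pow-[] (suc k) = pow-[] k

  pow-rotate : (d : A) (r : List A) (m : ℕ) → pow (d ∷ r) (suc m) ≡ d ∷ pow (r ++ d ∷ []) m ++ r
  pow-rotate d r m = cong (d ∷_) (sym (pow-conj r (d ∷ []) m))

  Rot : List A → List A → Set
  Rot x r = ∃[ y ] ∃[ z ] (x ≡ y ++ z × r ≡ z ++ y)

  rot-length : {x r : List A} → Rot x r → length r ≡ length x
  rot-length (y , z , refl , refl) = length-++-comm z y

  rot-perm : {x r : List A} → Rot x r → r ↭ x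
  rot-perm (y , z , refl , refl) = ++-comm z y

  rot-step : {x r : List A} {c : A} → Rot x (c ∷ r) → Rot x (r ++ c ∷ [])
  rot-step {r = r} {c} (y , []    , refl , refl) = c ∷ [] , r , ++-identityʳ (c ∷ r) , refl
  rot-step {c = c}     (y , d ∷ z , refl , refl) =
    y ++ c ∷ [] , z , sym (++-assoc y (c ∷ []) z) , ++-assoc z y (c ∷ [])

  last-letter : (u : List A) {b e : A} → (u ++ b ∷ []) ↭ (u ++ e ∷ []) → b ≡ e
  last-letter []      p = ∷-injectiveˡ (↭-singleton-inv p)
  last-letter (c ∷ u) p = last-letter u (drop-∷ p)

  rot-factor-square : {x r : List A} → Rot x r → Factor r (x ++ x)
  rot-factor-square (y , z , refl , refl) = y , z , (begin
    y ++ (z ++ y) ++ z  ≡⟨ cong (y ++_) (++-assoc z y z) ⟩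
    y ++ z ++ y ++ z    ≡⟨ ++-assoc y z _ ⟨
    (y ++ z) ++ y ++ z  ∎)

  -- Powers of a rotation r = zy of x = yz are factors of powers of x:
  -- x^(m+1) = y (zy)^m z.
  rot-power-factor : {x r : List A} (m : ℕ) → Rot x r → Factor (pow r m) (pow x (suc m))
  rot-power-factor m (y , z , refl , refl) = y , z , (begin
    y ++ pow (z ++ y) m ++ z    ≡⟨ ++-assoc y _ z ⟨
    (y ++ pow (z ++ y) m) ++ z  ≡⟨ cong (_++ z) (pow-conj y z m) ⟨
    (pow (y ++ z) m ++ y) ++ z  ≡⟨ ++-assoc (pow (y ++ z) m) y z ⟩
    pow (y ++ z) m ++ y ++ z    ≡⟨ pow-snoc (y ++ z) m ⟩
    (y ++ z) ++ pow (y ++ z) m  ∎)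

  Aligned : List A → List A → List A → Set
  Aligned x r u = Rot x r × ∃[ m ] Prefix u (pow r m)

  -- Every factor of a power of x is aligned at some rotation of x: an
  -- occurrence inside the first block x = pq starts a prefix of (qp)^k.
  factor⇒aligned : (x u : List A) (k : ℕ) → Factor u (pow x k) → ∃[ r ] Aligned x r u
  factor⇒aligned x []      zero    _                 = x , ([] , x , refl , sym (++-identityʳ x)) , 0 , ([] , refl)
  factor⇒aligned x (c ∷ u) zero    ([]    , s , ())
  factor⇒aligned x (c ∷ u) zero    (d ∷ p , s , ())
  factor⇒aligned x u       (suc k) (p , s , e) with levi p (u ++ s) x (pow x k) e
  ... | inj₁ (q , _ , later) = factor⇒aligned x u k (q , s , later)
  ... | inj₂ (q , refl , us≡qx) = q ++ p , (p , q , refl , refl) , suc k , s ++ p , (begin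
    u ++ s ++ p                      ≡⟨ ++-assoc u s p ⟨
    (u ++ s) ++ p                    ≡⟨ cong (_++ p) us≡qx ⟩
    (q ++ pow (p ++ q) k) ++ p       ≡⟨ ++-assoc q _ p ⟩
    q ++ pow (p ++ q) k ++ p         ≡⟨ cong (q ++_) (pow-conj p q k) ⟩
    q ++ p ++ pow (q ++ p) k         ≡⟨ ++-assoc q p _ ⟨
    (q ++ p) ++ pow (q ++ p) k       ∎)

  aligned : {x u : List A} → FactPow x u → ∃[ r ] Aligned x r u
  aligned {x} {u} (k , f) = factor⇒aligned x u k f

  aligned⇒factor : {x r u : List A} → Aligned x r u → FactPow x u
  aligned⇒factor (rot , m , pr) = suc m , factor-trans (prefix⇒factor pr) (rot-power-factor m rot)

  prefix-power-short : {u r : List A} (m : ℕ) → Prefix u (pow r m) → length u ≤ length r → Prefix u r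
  prefix-power-short {[]}    {r} zero    _        _  = r , refl
  prefix-power-short {c ∷ u}     zero    (t , ()) _
  prefix-power-short {r = r}     (suc m) pr       le = prefix-compare pr (pow r m , refl) le

  prefix-power-long : {u r : List A} (m : ℕ) → Prefix u (pow r m) → length r ≤ length u → Prefix r u
  prefix-power-long {[]}    {[]}    zero    _        _  = [] , refl
  prefix-power-long {[]}    {c ∷ r} zero    _        ()
  prefix-power-long {c ∷ u}         zero    (t , ()) _
  prefix-power-long {r = r}         (suc m) pr       le = prefix-compare (pow r m , refl) pr le

  short-factor : (x u : List A) → FactPow x u → length u ≤ length x → Factor u (x ++ x)
  short-factor x u f le with aligned f
  ... | r , rot , m , pr = factor-trans (prefix⇒factor u≼r) (rot-factor-square rot)
    where
    u≼r : Prefix u r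
    u≼r = prefix-power-short m pr (≤-trans le (≤-reflexive (sym (rot-length rot))))

  square-factor : {x u : List A} → Factor u (x ++ x) → FactPow x u
  square-factor {x} f = 2 , factor-trans f ([] , [] , ++-assoc x x [])

  factPow-factorial : {x v w : List A} → Factor w v → FactPow x v → FactPow x w
  factPow-factorial g (k , f) = k , factor-trans g f

  prefix-tail : {c d : A} {t r : List A} (m : ℕ) →
                Prefix (c ∷ t) (pow (d ∷ r) m) → c ≡ d × Prefix t (pow (r ++ d ∷ []) m)
  prefix-tail zero (s , ())
  prefix-tail {d = d} {t} {r} (suc m) (s , e) with ∷-injective (trans e (pow-rotate d r m))
  ... | refl , ts≡ = refl , s ++ d ∷ [] , (begin
    t ++ s ++ d ∷ []                    ≡⟨ ++-assoc t s _ ⟨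
    (t ++ s) ++ d ∷ []                  ≡⟨ cong (_++ d ∷ []) ts≡ ⟩
    (pow (r ++ d ∷ []) m ++ r) ++ d ∷ [] ≡⟨ ++-assoc (pow (r ++ d ∷ []) m) r _ ⟩
    pow (r ++ d ∷ []) m ++ r ++ d ∷ []   ≡⟨ pow-snoc (r ++ d ∷ []) m ⟩
    pow (r ++ d ∷ []) (suc m)           ∎)

  prefix-cons : {d : A} {t r : List A} (m : ℕ) →
                Prefix t (pow (r ++ d ∷ []) m) → Prefix (d ∷ t) (pow (d ∷ r) (suc m))
  prefix-cons {d} {t} {r} m (s , e) = s ++ r , (begin
    d ∷ t ++ s ++ r                  ≡⟨ cong (d ∷_) (++-assoc t s r) ⟨
    d ∷ (t ++ s) ++ r                ≡⟨ cong (λ w → d ∷ w ++ r) e ⟩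
    d ∷ pow (r ++ d ∷ []) m ++ r     ≡⟨ pow-rotate d r m ⟨
    pow (d ∷ r) (suc m)              ∎)

  realign : {x s t u : List A} {b : A} (m n : ℕ) → Rot x s → Rot x t →
            length x ≤ length (u ++ b ∷ []) →
            Prefix u (pow s m) → Prefix (u ++ b ∷ []) (pow t n) →
            ∃[ K ] Prefix (u ++ b ∷ []) (pow s K)
  realign {x} {s} {t} {u} {b} m n rot-s rot-t le pu pub with length x ≤? length u
  ... | yes x≤u = n , subst (λ q → Prefix (u ++ b ∷ []) (pow q n)) (sym s≡t) pub
    where
    -- s and t are both prefixes of u of length |x|
    s≡t : s ≡ t
    s≡t = prefix-unique
      (prefix-power-long m pu (≤-trans (≤-reflexive (rot-length rot-s)) x≤u))
      (prefix-power-long n (prefix-trans (b ∷ [] , refl) pub) (≤-trans (≤-reflexive (rot-length rot-t)) x≤u))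
      (trans (rot-length rot-s) (sym (rot-length rot-t)))
  ... | no x≰u = 1 , subst (λ w → Prefix w (pow s 1)) s≡ub ([] , refl)
    where
    -- here |x| = |u| + 1, so s = ue and t = ub are rotations of x
    |x|≡ : length x ≡ suc (length u)
    |x|≡ = ≤-antisym (≤-trans le (≤-reflexive (length-snoc u b))) (≰⇒> x≰u)
    |ub|≡|t| : length (u ++ b ∷ []) ≡ length t
    |ub|≡|t| = trans (length-snoc u b) (trans (sym |x|≡) (sym (rot-length rot-t)))
    s-last : ∃[ e ] (s ≡ u ++ e ∷ [])
    s-last = prefix-last
      (prefix-power-short m pu (≤-trans (n≤1+n _) (≤-reflexive (trans (sym |x|≡) (sym (rot-length rot-s))))))
      (trans (rot-length rot-s) |x|≡)
    t≡ub : t ≡ u ++ b ∷ []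
    t≡ub = sym (prefix-full (prefix-power-short n pub (≤-reflexive |ub|≡|t|)) (≤-reflexive (sym |ub|≡|t|)))
    b≡e : b ≡ proj₁ s-last
    b≡e = last-letter u (subst₂ _↭_ t≡ub (proj₂ s-last) (↭-trans (rot-perm rot-t) (↭-sym (rot-perm rot-s))))
    s≡ub : s ≡ u ++ b ∷ []
    s≡ub = trans (proj₂ s-last) (cong (λ c → u ++ c ∷ []) (sym b≡e))

  extend : (x : List A) {a b : A} (u : List A) → length x ≤ length (u ++ b ∷ []) →
           FactPow x (a ∷ u) → FactPow x (u ++ b ∷ []) → FactPow x (a ∷ u ++ b ∷ [])
  extend x u le fa fb with aligned fa | aligned fb
  ... | []    , _   , m , t , e | _ with trans e (pow-[] m)
  ...   | ()
  extend x u le fa fb | d ∷ r , rot , m , pau | t , rot' , n , pub with prefix-tail m pau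
  ... | refl , pu with realign m n (rot-step rot) rot' le pu pub
  ...   | K , pk = aligned⇒factor (rot , suc K , prefix-cons K pk)

  minForb-short : (x : List A) {a b : A} (u : List A) →
                  FactPow x (a ∷ u) → FactPow x (u ++ b ∷ []) → ¬ FactPow x (a ∷ u ++ b ∷ []) →
                  length (a ∷ u ++ b ∷ []) ≤ length x
  minForb-short x u fa fb absent with suc (length (u ++ _ ∷ [])) ≤? length x
  ... | yes short = short
  ... | no long   = ⊥-elim (absent (extend x u (≤-pred (≰⇒> long)) fa fb))

  proper-factor-split : {a b : A} (u v : List A) → Factor v (a ∷ u ++ b ∷ []) →
                        length v < length (a ∷ u ++ b ∷ []) → Factor v (a ∷ u) ⊎ Factor v (u ++ b ∷ [])
  proper-factor-split {b = b} u v ([] , s , e) lt =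
    inj₁ (prefix⇒factor (prefix-compare (s , e) (b ∷ [] , refl) (≤-trans (≤-pred lt) (≤-reflexive (length-snoc u b)))))
  proper-factor-split u v (c ∷ p , s , e) _ = inj₂ (p , s , ∷-injectiveʳ e)

  minForb⇒maw : (x v : List A) → MinForbCirc x v → MAWUpTo (x ++ x) (length x) v
  minForb⇒maw x v (a , u , b , refl , absent , fa , fb) = (absent ∘ square-factor , proper) , short
    where
    short : length v ≤ length x
    short = minForb-short x u fa fb absent
    proper : ∀ w → Factor w v → length w < length v → Factor w (x ++ x)
    proper w g lt with proper-factor-split u w g lt
    ... | inj₁ g' = short-factor x w (factPow-factorial g' fa) (<⇒≤ (≤-trans lt short))
    ... | inj₂ g' = short-factor x w (factPow-factorial g' fb) (<⇒≤ (≤-trans lt short))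

  -- M_{xx}^{|x|} ⊆ M_{x̃}, provided every letter occurs in x (this rules
  -- out the one-letter absent words).
  maw⇒minForb : (x : List A) → (∀ a → Factor (a ∷ []) x) →
                (v : List A) → MAWUpTo (x ++ x) (length x) v → MinForbCirc x v
  maw⇒minForb x letters []      ((absent , _) , _) = ⊥-elim (absent ([] , x ++ x , refl))
  maw⇒minForb x letters (a ∷ w) ((absent , proper) , short) with w | initLast w
  ... | .[]            | []       = ⊥-elim (absent (factor-trans (letters a) ([] , x , refl)))
  ... | .(u ++ b ∷ []) | u ∷ʳ′ b = a , u , b , refl , notFactor , square-factor au , square-factor ub
    where
    notFactor : ¬ FactPow x (a ∷ u ++ b ∷ [])
    notFactor f = absent (short-factor x _ f short)
    au : Factor (a ∷ u) (x ++ x)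
    au = proper (a ∷ u) ([] , b ∷ [] , refl) (s≤s (≤-reflexive (sym (length-snoc u b))))
    ub : Factor (u ++ b ∷ []) (x ++ x)
    ub = proper (u ++ b ∷ []) (a ∷ [] , [] , cong (a ∷_) (++-identityʳ _)) ≤-refl

lemma4 : {A : Set} (x : List A) →
         (∀ (a : A) → Factor (a ∷ []) x) →
         ∀ (v : List A) →
           (MinForbCirc x v → MAWUpTo (x ++ x) (length x) v) ×
           (MAWUpTo (x ++ x) (length x) v → MinForbCirc x v)
lemma4 x letters v = minForb⇒maw x v , maw⇒minForb x letters v
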